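{- Let $n\geq 4$ and let $G$ be any graph in $XQ_n$. Let $\{u_1,u_2,\ldots,u_{n+1}\}$ be a set of $n+1$ distinct nodes of $G$ such that the subgraph of $G$ induced by $\{u_1,\ldots,u_{n+1}\}$ is not isomorphic to the star $K_{1,n}$. Then there exist distinct nodes $v_1,v_2,\ldots,v_{n+1}$ in $V(G)-\{u_1,u_2,\ldots,u_{n+1}\}$ such that $\{u_i,v_i\}\in E(G)$ for every $1\leq i\leq n+1$.
   Context: Hypercube-like graphs: $XQ_1=\{K_2\}$, where $K_2$ is the complete graph on two nodes. For $n\geq 1$, if $G_0=(V_0,E_0)$ and $G_1=(V_1,E_1)$ are graphs in $XQ_n$ on disjoint node sets and $\phi:V_0\to V_1$ is any bijection, then the graph $G_0\oplus G_1$ with node set $V_0\cup V_1$ and edge set $E_0\cup E_1\cup\{\{v,\phi(v)\}\mid v\in V_0\}$ belongs to $XQ_{n+1}$; $XQ_{n+1}$ consists exactly of the graphs obtained in this way (for all choices of $G_0,G_1,\phi$). Every graph in $XQ_n$ is a simple $n$-regular graph on $2^n$ nodes. $K_{1,n}$ denotes the star with one center and $n$ leaves. -}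

module Defs where

open import Data.Nat using (ℕ; zero; suc)
open import Data.Bool using (Bool; true; false)
open import Data.Vec using (Vec; []; _∷_)
open import Data.Fin using (Fin; zero; suc)
open import Data.Product using (_×_; Σ; _,_)
open import Data.Sum using (_⊎_)
open import Relation.Nullary using (¬_)
open import Relation.Binary.PropositionalEquality using (_≡_; _≢_)
open import Function.Bundles using (_↔_; Inverse; _⇔_)

Bits : ℕ → Set
Bits n = Vec Bool n

-- Construction trees of hypercube-like graphs.  Every graph of XQ_n is
-- (up to renaming of nodes) given by such a tree:
--   k2          : XQ_1 = {K_2}
--   join G₀ G₁ φ : G₀ ⊕ G₁ where the copy G₀ lives on nodes 0x, G₁ on 1x,
--                 and φ is an arbitrary bijection between their node sets.
data XQ : ℕ → Set where
  k2   : XQ 1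
  join : {n : ℕ} → XQ n → XQ n → (Bits n ↔ Bits n) → XQ (suc n)

Adj : {n : ℕ} → XQ n → Bits n → Bits n → Set
Adj k2 (a ∷ []) (b ∷ []) = a ≢ b
Adj (join G₀ G₁ φ) (false ∷ x) (false ∷ y) = Adj G₀ x y
Adj (join G₀ G₁ φ) (true ∷ x) (true ∷ y) = Adj G₁ x y
Adj (join G₀ G₁ φ) (false ∷ x) (true ∷ y) = Inverse.to φ x ≡ y
Adj (join G₀ G₁ φ) (true ∷ x) (false ∷ y) = Inverse.to φ y ≡ x

StarAdj : {n : ℕ} → Fin (suc n) → Fin (suc n) → Set
StarAdj i j = (i ≡ zero × j ≢ zero) ⊎ (j ≡ zero × i ≢ zero)

Isomorphic : {A B : Set} → (A → A → Set) → (B → B → Set) → Set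
Isomorphic {A} {B} E F =
  Σ (A ↔ B) λ σ → ∀ x y → E x y ⇔ F (Inverse.to σ x) (Inverse.to σ y)

Induced : {n m : ℕ} → XQ n → (Fin m → Bits n) → Fin m → Fin m → Set
Induced G u i j = Adj G (u i) (u j)

{-# OPTIONS --safe #-}
module Submission where

-- Call a matching of U an injective choice, for every node of U, of a neighbour outside U.
-- In G = G₀ ⊕ G₁ of dimension n every set of at most n nodes has one: if a half of the set
-- is empty every node crosses along φ, otherwise both halves are small enough for induction.
-- Now let |U| = n + 1. Every node of U has a neighbour outside U, for otherwise, G being
-- triangle-free, U induces a star. If both halves of U hold at most n − 1 nodes, induction
-- applies again; otherwise one half, say in G₀, holds n nodes and the other a single node z.
-- If the cross neighbour y of z lies outside U everything crosses. If not, z is sent to a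
-- neighbour t in G₁ and all other nodes cross, except y and ℓ = φ⁻¹ t, which are matched
-- inside G₀ using the outside neighbour of y. This fails only if all neighbours of ℓ lie in U
-- (the alternative, that y and ℓ share all their n − 1 ≥ 3 neighbours, is excluded because two
-- nodes have at most two common neighbours), and by triangle-freeness it cannot fail for two
-- choices of t.

open import Defs
open import Data.Bool using (Bool; true; false; not)
import Data.Bool.Properties as Bool
open import Data.Empty using (⊥; ⊥-elim)
open import Data.Fin using (Fin; zero; suc)
open import Data.Fin.Patterns using (0F; 1F; 2F)
open import Data.Fin.Permutation using (transpose)
import Data.Fin.Properties as Fin
open import Data.List using (List; []; _∷_; [_]; length; filter; tabulate)
open import Data.List.Properties using (filter-notAll; length-tabulate)
open import Data.List.Membership.Propositional using (_∈_; _∉_)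
open import Data.List.Membership.Propositional.Properties
  using (∈-filter⁺; ∈-tabulate⁺; ∈-tabulate⁻)
open import Data.List.Membership.Setoid.Properties using (index-injective)
open import Data.List.Relation.Unary.Any as Any using (here; there)
open import Data.Nat using (ℕ; suc; _≤_; _<_; _+_; s≤s; _≤?_)
open import Data.Nat.Properties
  using (≤-trans; ≤-reflexive; ≤-pred; <-≤-trans; ≤-<-trans; <-irrefl; +-suc; +-comm;
         +-cancelˡ-≤; +-monoˡ-≤; m+n≤o⇒m≤o; m+n≤o⇒n≤o; ≰⇒>)
open import Data.Product using (Σ; ∃; _×_; _,_; proj₁; proj₂)
import Data.Product as Product
open import Data.Sum using (_⊎_; inj₁; inj₂; [_,_]′)
import Data.Sum as Sum
open import Data.Vec using (_∷_; [])
import Data.Vec.Properties as Vec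
open import Function using (_∘_; id)
open import Function.Bundles using (_↔_; Inverse; _⇔_; mk⇔; Injection)
open import Function.Definitions using (Injective)
open import Level using (0ℓ)
open import Function.Properties.Inverse using (↔-sym; ↔⇒↣)
open import Function.Construct.Composition using (_⇔-∘_)
open import Relation.Binary.Definitions using (DecidableEquality)
open import Relation.Binary.PropositionalEquality
  using (_≡_; _≢_; refl; sym; trans; cong; cong₂; subst; setoid)
open import Relation.Nullary using (¬_; Dec; yes; no; ¬?)
open import Relation.Nullary.Decidable using (decidable-stable)
open import Relation.Unary using (Pred; Decidable; _⊆_; _∪_; _∩_; _∖_; ｛_｝; ∅)
open import Relation.Unary.Properties using (_∪?_; _∩?_)

open Inverse using (to; from; inverseˡ; inverseʳ; strictlyInverseˡ; strictlyInverseʳ)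

pigeonhole₂ : ∀ {A : Set} {a b x y z : A} → x ≢ y → x ≢ z → y ≢ z →
              x ≡ a ⊎ x ≡ b → y ≡ a ⊎ y ≡ b → z ≡ a ⊎ z ≡ b → ⊥
pigeonhole₂ x≢y _ _ (inj₁ p) (inj₁ q) _ = x≢y (trans p (sym q))
pigeonhole₂ x≢y _ _ (inj₂ p) (inj₂ q) _ = x≢y (trans p (sym q))
pigeonhole₂ _ x≢z _ (inj₁ p) _ (inj₁ q) = x≢z (trans p (sym q))
pigeonhole₂ _ x≢z _ (inj₂ p) _ (inj₂ q) = x≢z (trans p (sym q))
pigeonhole₂ _ _ y≢z (inj₁ _) (inj₂ p) (inj₂ q) = y≢z (trans p (sym q))
pigeonhole₂ _ _ y≢z (inj₂ _) (inj₁ p) (inj₁ q) = y≢z (trans p (sym q))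

module _ {A : Set} (_≟ᴬ_ : DecidableEquality A) where

  remove : A → List A → List A
  remove x = filter (λ w → ¬? (w ≟ᴬ x))

  ∈-remove⁺ : ∀ {x w L} → w ∈ L → w ≢ x → w ∈ remove x L
  ∈-remove⁺ {x} = ∈-filter⁺ (λ w → ¬? (w ≟ᴬ x))

  length-remove : ∀ {x L} → x ∈ L → length (remove x L) < length L
  length-remove {x} {L} x∈L =
    filter-notAll (λ w → ¬? (w ≟ᴬ x)) L (Any.map (λ x≡w w≢x → w≢x (sym x≡w)) x∈L)

  injective⇒length≤ : ∀ {k L} (f : Fin k → A) → Injective _≡_ _≡_ f → (∀ i → f i ∈ L) →
                      k ≤ length L
  injective⇒length≤ f f-inj f∈L =
    Fin.injective⇒≤ {f = λ i → Any.index (f∈L i)}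
      (λ e → f-inj (index-injective (setoid A) (f∈L _) (f∈L _) e))

  injective⇒covers : ∀ {k L} (f : Fin k → A) → Injective _≡_ _≡_ f → (∀ i → f i ∈ L) →
                     length L ≤ k → ∀ {w} → w ∈ L → ∃ λ i → f i ≡ w
  injective⇒covers {k} {L} f f-inj f∈L L≤k {w} w∈L with Fin.any? (λ i → f i ≟ᴬ w)
  ... | yes hit = hit
  ... | no miss = ⊥-elim (<-irrefl refl (<-≤-trans k<L L≤k))
    where
    k<L : k < length L
    k<L = ≤-<-trans (injective⇒length≤ f f-inj (λ i → ∈-remove⁺ (f∈L i) (λ e → miss (i , e))))
                    (length-remove w∈L)

to-injective : ∀ {A B : Set} (φ : A ↔ B) → Injective _≡_ _≡_ (to φ)
to-injective φ = Injection.injective (↔⇒↣ φ)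

from-injective : ∀ {A B : Set} (φ : A ↔ B) → Injective _≡_ _≡_ (from φ)
from-injective φ = to-injective (↔-sym φ)

_≟_ : ∀ {n} → DecidableEquality (Bits n)
_≟_ = Vec.≡-dec Bool._≟_

_∈?_ : ∀ {n} (x : Bits n) L → Dec (x ∈ L)
x ∈? L = Any.any? (x ≟_) L

bits₁ : (x : Bits 1) → x ≡ false ∷ [] ⊎ x ≡ true ∷ []
bits₁ (false ∷ []) = inj₁ refl
bits₁ (true ∷ []) = inj₂ refl

-- Adjacency, neighbours and local structure of hypercube-like graphs

cross : ∀ {n} → (Bits n ↔ Bits n) → Bits (suc n) → Bits (suc n)
cross φ (false ∷ x) = true ∷ to φ x
cross φ (true ∷ x) = false ∷ from φ x

cross-involutive : ∀ {n} (φ : Bits n ↔ Bits n) x → cross φ (cross φ x) ≡ x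
cross-involutive φ (false ∷ x) = cong (false ∷_) (strictlyInverseʳ φ x)
cross-involutive φ (true ∷ x) = cong (true ∷_) (strictlyInverseˡ φ x)

cross-injective : ∀ {n} (φ : Bits n ↔ Bits n) → Injective _≡_ _≡_ (cross φ)
cross-injective φ {x} {y} e =
  trans (sym (cross-involutive φ x)) (trans (cong (cross φ) e) (cross-involutive φ y))

cross-adj : ∀ {n} (G₀ G₁ : XQ n) φ x → Adj (join G₀ G₁ φ) x (cross φ x)
cross-adj G₀ G₁ φ (false ∷ x) = refl
cross-adj G₀ G₁ φ (true ∷ x) = strictlyInverseˡ φ x

adj? : ∀ {n} (G : XQ n) x y → Dec (Adj G x y)
adj? k2 (a ∷ []) (b ∷ []) = ¬? (a Bool.≟ b)
adj? (join G₀ G₁ φ) (false ∷ x) (false ∷ y) = adj? G₀ x y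
adj? (join G₀ G₁ φ) (true ∷ x) (true ∷ y) = adj? G₁ x y
adj? (join G₀ G₁ φ) (false ∷ x) (true ∷ y) = to φ x ≟ y
adj? (join G₀ G₁ φ) (true ∷ x) (false ∷ y) = to φ y ≟ x

adj-irrefl : ∀ {n} (G : XQ n) {x} → ¬ Adj G x x
adj-irrefl k2 {a ∷ []} a≢a = a≢a refl
adj-irrefl (join G₀ G₁ φ) {false ∷ x} = adj-irrefl G₀
adj-irrefl (join G₀ G₁ φ) {true ∷ x} = adj-irrefl G₁

adj⇒≢ : ∀ {n} (G : XQ n) {x y} → Adj G x y → x ≢ y
adj⇒≢ G a refl = adj-irrefl G a

adj-sym : ∀ {n} (G : XQ n) {x y} → Adj G x y → Adj G y x
adj-sym k2 {a ∷ []} {b ∷ []} a≢b = a≢b ∘ sym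
adj-sym (join G₀ G₁ φ) {false ∷ x} {false ∷ y} = adj-sym G₀
adj-sym (join G₀ G₁ φ) {true ∷ x} {true ∷ y} = adj-sym G₁
adj-sym (join G₀ G₁ φ) {false ∷ x} {true ∷ y} = id
adj-sym (join G₀ G₁ φ) {true ∷ x} {false ∷ y} = id

neighbour : ∀ {n} → XQ n → Bits n → Fin n → Bits n
neighbour k2 (a ∷ []) zero = not a ∷ []
neighbour (join G₀ G₁ φ) v zero = cross φ v
neighbour (join G₀ G₁ φ) (false ∷ x) (suc i) = false ∷ neighbour G₀ x i
neighbour (join G₀ G₁ φ) (true ∷ x) (suc i) = true ∷ neighbour G₁ x i

neighbour-adj : ∀ {n} (G : XQ n) x i → Adj G x (neighbour G x i)
neighbour-adj k2 (a ∷ []) zero = Bool.not-¬ refl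
neighbour-adj (join G₀ G₁ φ) v zero = cross-adj G₀ G₁ φ v
neighbour-adj (join G₀ G₁ φ) (false ∷ x) (suc i) = neighbour-adj G₀ x i
neighbour-adj (join G₀ G₁ φ) (true ∷ x) (suc i) = neighbour-adj G₁ x i

neighbour-injective : ∀ {n} (G : XQ n) x → Injective _≡_ _≡_ (neighbour G x)
neighbour-injective k2 (a ∷ []) {zero} {zero} _ = refl
neighbour-injective (join G₀ G₁ φ) x {zero} {zero} _ = refl
neighbour-injective (join G₀ G₁ φ) (false ∷ x) {suc i} {suc j} e =
  cong suc (neighbour-injective G₀ x (Vec.∷-injectiveʳ e))
neighbour-injective (join G₀ G₁ φ) (true ∷ x) {suc i} {suc j} e =
  cong suc (neighbour-injective G₁ x (Vec.∷-injectiveʳ e))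
neighbour-injective (join G₀ G₁ φ) (false ∷ x) {zero} {suc j} ()
neighbour-injective (join G₀ G₁ φ) (false ∷ x) {suc i} {zero} ()
neighbour-injective (join G₀ G₁ φ) (true ∷ x) {zero} {suc j} ()
neighbour-injective (join G₀ G₁ φ) (true ∷ x) {suc i} {zero} ()

adj⇒neighbour : ∀ {n} (G : XQ n) {x y} → Adj G x y → ∃ λ i → neighbour G x i ≡ y
adj⇒neighbour k2 {false ∷ []} {false ∷ []} a = ⊥-elim (a refl)
adj⇒neighbour k2 {false ∷ []} {true ∷ []} _ = zero , refl
adj⇒neighbour k2 {true ∷ []} {false ∷ []} _ = zero , refl
adj⇒neighbour k2 {true ∷ []} {true ∷ []} a = ⊥-elim (a refl)
adj⇒neighbour (join G₀ G₁ φ) {false ∷ x} {false ∷ y} a with adj⇒neighbour G₀ a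
... | i , e = suc i , cong (false ∷_) e
adj⇒neighbour (join G₀ G₁ φ) {true ∷ x} {true ∷ y} a with adj⇒neighbour G₁ a
... | i , e = suc i , cong (true ∷_) e
adj⇒neighbour (join G₀ G₁ φ) {false ∷ x} {true ∷ y} a = zero , cong (true ∷_) a
adj⇒neighbour (join G₀ G₁ φ) {true ∷ x} {false ∷ y} a = zero , cong (false ∷_) (inverseʳ φ (sym a))

triangle-free : ∀ {n} (G : XQ n) {x y w} → Adj G x y → Adj G y w → Adj G x w → ⊥
triangle-free k2 {x@(_ ∷ [])} {y@(_ ∷ [])} {w@(_ ∷ [])} p q r =
  pigeonhole₂ (p ∘ Vec.∷-injectiveˡ) (r ∘ Vec.∷-injectiveˡ) (q ∘ Vec.∷-injectiveˡ)
              (bits₁ x) (bits₁ y) (bits₁ w)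
triangle-free (join G₀ G₁ φ) {false ∷ x} {false ∷ y} {false ∷ w} = triangle-free G₀
triangle-free (join G₀ G₁ φ) {true ∷ x} {true ∷ y} {true ∷ w} = triangle-free G₁
triangle-free (join G₀ G₁ φ) {false ∷ x} {false ∷ y} {true ∷ w} p q r =
  adj⇒≢ G₀ p (to-injective φ (trans r (sym q)))
triangle-free (join G₀ G₁ φ) {false ∷ x} {true ∷ y} {false ∷ w} p q r =
  adj⇒≢ G₀ r (to-injective φ (trans p (sym q)))
triangle-free (join G₀ G₁ φ) {true ∷ x} {false ∷ y} {false ∷ w} p q r =
  adj⇒≢ G₀ q (to-injective φ (trans p (sym r)))
triangle-free (join G₀ G₁ φ) {false ∷ x} {true ∷ y} {true ∷ w} p q r =
  adj⇒≢ G₁ q (trans (sym p) r)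
triangle-free (join G₀ G₁ φ) {true ∷ x} {false ∷ y} {true ∷ w} p q r =
  adj⇒≢ G₁ r (trans (sym p) q)
triangle-free (join G₀ G₁ φ) {true ∷ x} {true ∷ y} {false ∷ w} p q r =
  adj⇒≢ G₁ p (trans (sym r) q)

CommonNeighbour : ∀ {n} → XQ n → Bits n → Bits n → Bits n → Set
CommonNeighbour G x y w = Adj G x w × Adj G y w

common-neighbour-across : ∀ {n} (G₀ G₁ : XQ n) φ {x y w} →
  CommonNeighbour (join G₀ G₁ φ) (false ∷ x) (true ∷ y) w →
  w ≡ cross φ (false ∷ x) ⊎ w ≡ cross φ (true ∷ y)
common-neighbour-across G₀ G₁ φ {w = true ∷ w} (p , _) = inj₁ (cong (true ∷_) (sym p))
common-neighbour-across G₀ G₁ φ {w = false ∷ w} (_ , q) =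
  inj₂ (cong (false ∷_) (sym (inverseʳ φ (sym q))))

no-three-common-neighbours : ∀ {n} (G : XQ n) {x y w₁ w₂ w₃} → x ≢ y →
  w₁ ≢ w₂ → w₁ ≢ w₃ → w₂ ≢ w₃ →
  CommonNeighbour G x y w₁ → CommonNeighbour G x y w₂ → CommonNeighbour G x y w₃ → ⊥
no-three-common-neighbours k2 {w₁ = w₁} {w₂} {w₃} _ d₁₂ d₁₃ d₂₃ _ _ _ =
  pigeonhole₂ d₁₂ d₁₃ d₂₃ (bits₁ w₁) (bits₁ w₂) (bits₁ w₃)
no-three-common-neighbours (join G₀ G₁ φ) {false ∷ x} {false ∷ y} {false ∷ w₁} {false ∷ w₂} {false ∷ w₃}
  x≢y d₁₂ d₁₃ d₂₃ =
  no-three-common-neighbours G₀ (x≢y ∘ cong _) (d₁₂ ∘ cong _) (d₁₃ ∘ cong _) (d₂₃ ∘ cong _)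
no-three-common-neighbours (join G₀ G₁ φ) {true ∷ x} {true ∷ y} {true ∷ w₁} {true ∷ w₂} {true ∷ w₃}
  x≢y d₁₂ d₁₃ d₂₃ =
  no-three-common-neighbours G₁ (x≢y ∘ cong _) (d₁₂ ∘ cong _) (d₁₃ ∘ cong _) (d₂₃ ∘ cong _)
no-three-common-neighbours (join G₀ G₁ φ) {false ∷ x} {true ∷ y} x≢y d₁₂ d₁₃ d₂₃ c₁ c₂ c₃ =
  pigeonhole₂ d₁₂ d₁₃ d₂₃ (across c₁) (across c₂) (across c₃)
  where across = common-neighbour-across G₀ G₁ φ
no-three-common-neighbours (join G₀ G₁ φ) {true ∷ x} {false ∷ y} x≢y d₁₂ d₁₃ d₂₃ c₁ c₂ c₃ =
  pigeonhole₂ d₁₂ d₁₃ d₂₃ (across c₁) (across c₂) (across c₃)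
  where
  across : ∀ {w} → CommonNeighbour (join G₀ G₁ φ) (true ∷ x) (false ∷ y) w →
           w ≡ cross φ (false ∷ y) ⊎ w ≡ cross φ (true ∷ x)
  across (p , q) = common-neighbour-across G₀ G₁ φ (q , p)
no-three-common-neighbours (join _ _ φ) {false ∷ _} {false ∷ _} {true ∷ _} x≢y _ _ _ (p , q) _ _ =
  x≢y (cong _ (to-injective φ (trans p (sym q))))
no-three-common-neighbours (join _ _ φ) {false ∷ _} {false ∷ _} {w₂ = true ∷ _} x≢y _ _ _ _ (p , q) _ =
  x≢y (cong _ (to-injective φ (trans p (sym q))))
no-three-common-neighbours (join _ _ φ) {false ∷ _} {false ∷ _} {w₃ = true ∷ _} x≢y _ _ _ _ _ (p , q) =
  x≢y (cong _ (to-injective φ (trans p (sym q))))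
no-three-common-neighbours (join _ _ φ) {true ∷ _} {true ∷ _} {false ∷ _} x≢y _ _ _ (p , q) _ _ =
  x≢y (cong _ (trans (sym p) q))
no-three-common-neighbours (join _ _ φ) {true ∷ _} {true ∷ _} {w₂ = false ∷ _} x≢y _ _ _ _ (p , q) _ =
  x≢y (cong _ (trans (sym p) q))
no-three-common-neighbours (join _ _ φ) {true ∷ _} {true ∷ _} {w₃ = false ∷ _} x≢y _ _ _ _ _ (p , q) =
  x≢y (cong _ (trans (sym p) q))

neighbour-avoiding : ∀ {n} (G : XQ (2 + n)) x v → ∃ λ w → Adj G x w × w ≢ v
neighbour-avoiding G x v with neighbour G x zero ≟ v
... | no w≢v = neighbour G x zero , neighbour-adj G x zero , w≢v
... | yes refl = neighbour G x (suc zero) , neighbour-adj G x (suc zero) ,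
                 λ e → Fin.0≢1+n (neighbour-injective G x (sym e))

Exit : ∀ {n} → XQ n → Pred (Bits n) 0ℓ → Bits n → Set
Exit G P x = ∃ λ w → Adj G x w × ¬ P w

ExitsFrom : ∀ {n} → XQ n → Pred (Bits n) 0ℓ → Set
ExitsFrom G U = ∀ x → U x → Exit G U x

NeighboursIn : ∀ {n} → XQ n → Pred (Bits n) 0ℓ → Bits n → Set
NeighboursIn G P x = ∀ {w} → Adj G x w → P w

exit? : ∀ {n} (G : XQ n) {P : Pred (Bits n) 0ℓ} → Decidable P →
        ∀ x → Exit G P x ⊎ NeighboursIn G P x
exit? G {P} P? x with Fin.any? (λ i → ¬? (P? (neighbour G x i)))
... | yes (i , ¬P) = inj₁ (neighbour G x i , neighbour-adj G x i , ¬P)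
... | no none = inj₂ closed
  where
  closed : NeighboursIn G P x
  closed a with adj⇒neighbour G a
  ... | i , refl = decidable-stable (P? _) (λ ¬P → none (i , ¬P))

neighboursIn-∷ : ∀ {n} (G : XQ n) {L a x} → ¬ Adj G x a → NeighboursIn G (_∈ a ∷ L) x →
                 NeighboursIn G (_∈ L) x
neighboursIn-∷ G x≁a closed xw with closed xw
... | here refl = ⊥-elim (x≁a xw)
... | there w∈L = w∈L

neighboursIn⇒adjacent : ∀ {n} (G : XQ n) {L x} → x ∈ L → length L ≤ suc n →
  NeighboursIn G (_∈ L) x → ∀ {w} → w ∈ L → w ≢ x → Adj G x w
neighboursIn⇒adjacent {n} G {L} {x} x∈L L≤ closed w∈L w≢x =
  let i , neighbour≡w = injective⇒covers _≟_ (neighbour G x) (neighbour-injective G x)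
                          neighbour∈ L′≤n (∈-remove⁺ _≟_ w∈L w≢x)
  in subst (Adj G x) neighbour≡w (neighbour-adj G x i)
  where
  neighbour∈ : ∀ i → neighbour G x i ∈ remove _≟_ x L
  neighbour∈ i = ∈-remove⁺ _≟_ (closed (neighbour-adj G x i)) (adj⇒≢ G (neighbour-adj G x i) ∘ sym)
  L′≤n : length (remove _≟_ x L) ≤ n
  L′≤n = ≤-pred (<-≤-trans (length-remove _≟_ x∈L) L≤)

no-two-closed : ∀ {n} (G : XQ (2 + n)) {L ℓ₁ ℓ₂} → length L ≤ 3 + n →
  ℓ₁ ∈ L → ℓ₂ ∈ L → ℓ₁ ≢ ℓ₂ → NeighboursIn G (_∈ L) ℓ₁ → NeighboursIn G (_∈ L) ℓ₂ → ⊥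
no-two-closed G {L} {ℓ₁} {ℓ₂} L≤ ℓ₁∈L ℓ₂∈L ℓ₁≢ℓ₂ closed₁ closed₂ =
  let w , ℓ₂w , w≢ℓ₁ = neighbour-avoiding G ℓ₂ ℓ₁
  in triangle-free G (adjacent₁ ℓ₂∈L (ℓ₁≢ℓ₂ ∘ sym)) ℓ₂w (adjacent₁ (closed₂ ℓ₂w) w≢ℓ₁)
  where
  adjacent₁ : ∀ {w} → w ∈ L → w ≢ ℓ₁ → Adj G ℓ₁ w
  adjacent₁ = neighboursIn⇒adjacent G ℓ₁∈L L≤ closed₁

no-closed-twins : ∀ {n} (G : XQ (3 + n)) {L y ℓ} → length L ≤ 5 + n →
  y ∈ L → ℓ ∈ L → y ≢ ℓ → ¬ Adj G y ℓ → NeighboursIn G (_∈ L) y → NeighboursIn G (_∈ L) ℓ → ⊥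
no-closed-twins G {L} {y} {ℓ} L≤ y∈L ℓ∈L y≢ℓ y≁ℓ closed-y closed-ℓ =
  no-three-common-neighbours G y≢ℓ (distinct λ ()) (distinct λ ()) (distinct λ ())
    (common 0F) (common 1F) (common 2F)
  where
  adjacent-y : ∀ {w} → w ∈ remove _≟_ ℓ L → w ≢ y → Adj G y w
  adjacent-y = neighboursIn⇒adjacent G (∈-remove⁺ _≟_ y∈L y≢ℓ)
    (≤-pred (<-≤-trans (length-remove _≟_ ℓ∈L) L≤))
    (λ a → ∈-remove⁺ _≟_ (closed-y a) (λ w≡ℓ → y≁ℓ (subst (Adj G y) w≡ℓ a)))
  common : ∀ i → CommonNeighbour G y ℓ (neighbour G ℓ i)
  common i = adjacent-y (∈-remove⁺ _≟_ (closed-ℓ ℓw) (adj⇒≢ G ℓw ∘ sym))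
                        (λ w≡y → y≁ℓ (adj-sym G (subst (Adj G ℓ) w≡y ℓw)))
           , ℓw
    where
    ℓw : Adj G ℓ (neighbour G ℓ i)
    ℓw = neighbour-adj G ℓ i
  distinct : ∀ {i j} → i ≢ j → neighbour G ℓ i ≢ neighbour G ℓ j
  distinct i≢j = i≢j ∘ neighbour-injective G ℓ

-- Stars

StarAt : ∀ {m} → Fin m → Fin m → Fin m → Set
StarAt c i j = (i ≡ c × j ≢ c) ⊎ (j ≡ c × i ≢ c)

star-centred⇒isomorphic : ∀ {n} {E : Fin (suc n) → Fin (suc n) → Set} c →
  (∀ i j → E i j ⇔ StarAt c i j) → Isomorphic E (StarAdj {n})
star-centred⇒isomorphic {n} c star = σ , λ i j → mk⇔ recentre uncentre ⇔-∘ star i j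
  where
  σ : Fin (suc n) ↔ Fin (suc n)
  σ = transpose c zero
  ⇒zero : ∀ {k} → k ≡ c → to σ k ≡ zero
  ⇒zero refl = inverseˡ σ refl
  ⇐zero : ∀ {k} → to σ k ≡ zero → k ≡ c
  ⇐zero = sym ∘ inverseʳ σ ∘ sym
  recentre : ∀ {i j} → StarAt c i j → StarAt zero (to σ i) (to σ j)
  recentre = Sum.map (Product.map ⇒zero (_∘ ⇐zero)) (Product.map ⇒zero (_∘ ⇐zero))
  uncentre : ∀ {i j} → StarAt zero (to σ i) (to σ j) → StarAt c i j
  uncentre = Sum.map (Product.map ⇐zero (_∘ ⇒zero)) (Product.map ⇐zero (_∘ ⇒zero))

not-star⇒exit : ∀ {n} (G : XQ n) (u : Fin (suc n) → Bits n) → Injective _≡_ _≡_ u →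
  ¬ Isomorphic (Induced G u) (StarAdj {n}) → ∀ c → Exit G (_∈ tabulate u) (u c)
not-star⇒exit G u u-inj not-star c with exit? G (_∈? tabulate u) (u c)
... | inj₁ exit = exit
... | inj₂ closed = ⊥-elim (not-star (star-centred⇒isomorphic c star))
  where
  adjacent : ∀ {j} → j ≢ c → Adj G (u c) (u j)
  adjacent {j} j≢c =
    neighboursIn⇒adjacent G (∈-tabulate⁺ {f = u} c) (≤-reflexive (length-tabulate u)) closed
                            (∈-tabulate⁺ {f = u} j) (j≢c ∘ u-inj)
  classify : ∀ i j → Adj G (u i) (u j) → StarAt c i j
  classify i j a with i Fin.≟ c | j Fin.≟ c
  ... | yes refl | yes refl = ⊥-elim (adj-irrefl G a)
  ... | yes i≡c | no j≢c = inj₁ (i≡c , j≢c)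
  ... | no i≢c | yes j≡c = inj₂ (j≡c , i≢c)
  ... | no i≢c | no j≢c = ⊥-elim (triangle-free G (adjacent i≢c) a (adjacent j≢c))
  star-edge : ∀ {i j} → StarAt c i j → Adj G (u i) (u j)
  star-edge (inj₁ (refl , j≢c)) = adjacent j≢c
  star-edge (inj₂ (refl , i≢c)) = adj-sym G (adjacent i≢c)
  star : ∀ i j → Induced G u i j ⇔ StarAt c i j
  star i j = mk⇔ (classify i j) star-edge

-- Matchings into the complement of a set

-- The nodes of S are matched to neighbours outside T; keeping T apart from S lets matchings of
-- parts of a set be combined into one for the whole set.
record Matching {n} (G : XQ n) (S T : Pred (Bits n) 0ℓ) : Set where
  field
    partner           : Bits n → Bits n
    partner-adj       : ∀ {x} → S x → Adj G x (partner x)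
    partner-injective : ∀ {x y} → S x → S y → partner x ≡ partner y → x ≡ y
    partner-∉         : ∀ {x} → S x → ¬ T (partner x)

open Matching

module _ {n} {G : XQ n} where

  restrict : ∀ {S S′ T T′} → S′ ⊆ S → T′ ⊆ T → Matching G S T → Matching G S′ T′
  restrict S′⊆S T′⊆T M = record
    { partner           = partner M
    ; partner-adj       = partner-adj M ∘ S′⊆S
    ; partner-injective = λ s s′ → partner-injective M (S′⊆S s) (S′⊆S s′)
    ; partner-∉         = λ s → partner-∉ M (S′⊆S s) ∘ T′⊆T
    }

  empty-matching : ∀ {T} → Matching G (_∈ []) T
  empty-matching = record
    { partner = id ; partner-adj = λ () ; partner-injective = λ () ; partner-∉ = λ () }

  singleton-matching : ∀ {T x w} → Adj G x w → ¬ T w → Matching G ｛ x ｝ T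
  singleton-matching {w = w} xw ¬Tw = record
    { partner           = λ _ → w
    ; partner-adj       = λ { refl → xw }
    ; partner-injective = λ { refl refl _ → refl }
    ; partner-∉         = λ _ → ¬Tw
    }

module _ {n} {G : XQ n} {S₁ S₂ T : Pred (Bits n) 0ℓ} (S₂? : Decidable S₂)
         (M₁ : Matching G S₁ T) (M₂ : Matching G S₂ T) where

  private
    choose : ∀ x → Dec (S₂ x) → Bits n
    choose x (yes _) = partner M₂ x
    choose x (no _) = partner M₁ x

    data Served (x : Bits n) : Bits n → Set where
      by₁ : S₁ x → Served x (partner M₁ x)
      by₂ : S₂ x → Served x (partner M₂ x)

    served : ∀ {x} → (S₁ ∪ S₂) x → Served x (choose x (S₂? x))
    served {x} s with S₂? x | s
    ... | yes s₂ | _ = by₂ s₂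
    ... | no _ | inj₁ s₁ = by₁ s₁
    ... | no ¬s₂ | inj₂ s₂ = ⊥-elim (¬s₂ s₂)

  union-matching : (∀ {x y} → S₁ x → S₂ y → partner M₁ x ≢ partner M₂ y) → Matching G (S₁ ∪ S₂) T
  union-matching disjoint = record
    { partner           = λ x → choose x (S₂? x)
    ; partner-adj       = adj ∘ served
    ; partner-injective = λ s s′ → injective (served s) (served s′)
    ; partner-∉         = avoid ∘ served
    }
    where
    adj : ∀ {x v} → Served x v → Adj G x v
    adj (by₁ s) = partner-adj M₁ s
    adj (by₂ s) = partner-adj M₂ s
    injective : ∀ {x y v w} → Served x v → Served y w → v ≡ w → x ≡ y
    injective (by₁ s) (by₁ s′) = partner-injective M₁ s s′
    injective (by₂ s) (by₂ s′) = partner-injective M₂ s s′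
    injective (by₁ s) (by₂ s′) e = ⊥-elim (disjoint s s′ e)
    injective (by₂ s) (by₁ s′) e = ⊥-elim (disjoint s′ s (sym e))
    avoid : ∀ {x v} → Served x v → ¬ T v
    avoid (by₁ s) = partner-∉ M₁ s
    avoid (by₂ s) = partner-∉ M₂ s

_⊕_ : ∀ {n} → Pred (Bits n) 0ℓ → Pred (Bits n) 0ℓ → Pred (Bits (suc n)) 0ℓ
(P ⊕ Q) (false ∷ x) = P x
(P ⊕ Q) (true ∷ x) = Q x

module _ {n} (G₀ G₁ : XQ n) (φ : Bits n ↔ Bits n) where

  join-matching : ∀ {S₀ S₁ T₀ T₁} → Matching G₀ S₀ T₀ → Matching G₁ S₁ T₁ →
                  Matching (join G₀ G₁ φ) (S₀ ⊕ S₁) (T₀ ⊕ T₁)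
  join-matching {S₀} {S₁} {T₀} {T₁} M₀ M₁ = record
    { partner           = pair
    ; partner-adj       = λ {x} → adj {x}
    ; partner-injective = λ {x} {y} → injective {x} {y}
    ; partner-∉         = λ {x} → avoid {x}
    }
    where
    pair : Bits (suc n) → Bits (suc n)
    pair (false ∷ x) = false ∷ partner M₀ x
    pair (true ∷ x) = true ∷ partner M₁ x
    adj : ∀ {x} → (S₀ ⊕ S₁) x → Adj (join G₀ G₁ φ) x (pair x)
    adj {false ∷ x} = partner-adj M₀
    adj {true ∷ x} = partner-adj M₁
    injective : ∀ {x y} → (S₀ ⊕ S₁) x → (S₀ ⊕ S₁) y → pair x ≡ pair y → x ≡ y
    injective {false ∷ x} {false ∷ y} s s′ e = cong _ (partner-injective M₀ s s′ (Vec.∷-injectiveʳ e))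
    injective {true ∷ x} {true ∷ y} s s′ e = cong _ (partner-injective M₁ s s′ (Vec.∷-injectiveʳ e))
    injective {false ∷ x} {true ∷ y} _ _ ()
    injective {true ∷ x} {false ∷ y} _ _ ()
    avoid : ∀ {x} → (S₀ ⊕ S₁) x → ¬ (T₀ ⊕ T₁) (pair x)
    avoid {false ∷ x} = partner-∉ M₀
    avoid {true ∷ x} = partner-∉ M₁

  cross-matching : ∀ {S T} → (∀ x → S x → ¬ T (cross φ x)) → Matching (join G₀ G₁ φ) S T
  cross-matching avoid = record
    { partner           = cross φ
    ; partner-adj       = λ {x} _ → cross-adj G₀ G₁ φ x
    ; partner-injective = λ _ _ → cross-injective φ
    ; partner-∉         = avoid _
    }

pair-matching : ∀ {n} (G : XQ n) {T y ℓ a b} → Adj G y a → ¬ T a → Adj G ℓ b → ¬ T b → a ≢ b →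
                Matching G (｛ y ｝ ∪ ｛ ℓ ｝) T
pair-matching G {ℓ = ℓ} ya ¬Ta ℓb ¬Tb a≢b =
  union-matching (ℓ ≟_) (singleton-matching ya ¬Ta) (singleton-matching ℓb ¬Tb) (λ _ _ → a≢b)

swap : ∀ {n} → Bits (suc n) → Bits (suc n)
swap (b ∷ x) = not b ∷ x

swap-injective : ∀ {n} → Injective _≡_ _≡_ (swap {n})
swap-injective {x = b ∷ x} {c ∷ y} e =
  cong₂ _∷_ (Bool.not-injective (Vec.∷-injectiveˡ e)) (Vec.∷-injectiveʳ e)

⊕-swap : ∀ {n} {P Q : Pred (Bits n) 0ℓ} x → (P ⊕ Q) x → (Q ⊕ P) (swap x)
⊕-swap (false ∷ x) = id
⊕-swap (true ∷ x) = id

swap-⊕ : ∀ {n} {P Q : Pred (Bits n) 0ℓ} x → (P ⊕ Q) (swap x) → (Q ⊕ P) x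
swap-⊕ (false ∷ x) = id
swap-⊕ (true ∷ x) = id

module _ {n} (G₀ G₁ : XQ n) (φ : Bits n ↔ Bits n) where

  private
    G = join G₀ G₁ φ
    G′ = join G₁ G₀ (↔-sym φ)

  swap-adj : ∀ {x y} → Adj G x y → Adj G′ (swap x) (swap y)
  swap-adj {false ∷ x} {false ∷ y} = id
  swap-adj {true ∷ x} {true ∷ y} = id
  swap-adj {false ∷ x} {true ∷ y} xy = inverseʳ φ (sym xy)
  swap-adj {true ∷ x} {false ∷ y} yx = inverseʳ φ (sym yx)

  swap-adj⁻ : ∀ {x y} → Adj G′ (swap x) y → Adj G x (swap y)
  swap-adj⁻ {false ∷ x} {true ∷ y} = id
  swap-adj⁻ {true ∷ x} {false ∷ y} = id
  swap-adj⁻ {false ∷ x} {false ∷ y} yx = inverseˡ φ (sym yx)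
  swap-adj⁻ {true ∷ x} {true ∷ y} xy = inverseˡ φ (sym xy)

  swap-exit : ∀ {P Q : Pred (Bits n) 0ℓ} x → Exit G (P ⊕ Q) x → Exit G′ (Q ⊕ P) (swap x)
  swap-exit x (w , xw , ¬Pw) = swap w , swap-adj {x} {w} xw , ¬Pw ∘ swap-⊕ w

  swap-matching : ∀ {S₀ S₁ T₀ T₁} → Matching G′ (S₁ ⊕ S₀) (T₁ ⊕ T₀) →
                  Matching G (S₀ ⊕ S₁) (T₀ ⊕ T₁)
  swap-matching M = record
    { partner           = swap ∘ partner M ∘ swap
    ; partner-adj       = λ {x} s → swap-adj⁻ {x} (partner-adj M {swap x} (⊕-swap x s))
    ; partner-injective = λ {x} {y} s s′ →
        swap-injective ∘ partner-injective M {swap x} {swap y} (⊕-swap x s) (⊕-swap y s′) ∘ swap-injective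
    ; partner-∉         = λ {x} s → partner-∉ M {swap x} (⊕-swap x s) ∘ swap-⊕ (partner M (swap x))
    }

half : ∀ {n} → Bool → List (Bits (suc n)) → List (Bits n)
half b [] = []
half false ((false ∷ x) ∷ U) = x ∷ half false U
half false ((true ∷ x) ∷ U) = half false U
half true ((false ∷ x) ∷ U) = half true U
half true ((true ∷ x) ∷ U) = x ∷ half true U

Halves : ∀ {n} → List (Bits (suc n)) → Pred (Bits (suc n)) 0ℓ
Halves U = (_∈ half false U) ⊕ (_∈ half true U)

∈⇒∈-halves : ∀ {n} {U : List (Bits (suc n))} → (_∈ U) ⊆ Halves U
∈⇒∈-halves {U = (false ∷ v) ∷ U} (here refl) = here refl
∈⇒∈-halves {U = (true ∷ v) ∷ U} (here refl) = here refl
∈⇒∈-halves {U = (false ∷ v) ∷ U} {false ∷ x} (there p) = there (∈⇒∈-halves p)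
∈⇒∈-halves {U = (false ∷ v) ∷ U} {true ∷ x} (there p) = ∈⇒∈-halves p
∈⇒∈-halves {U = (true ∷ v) ∷ U} {false ∷ x} (there p) = ∈⇒∈-halves p
∈⇒∈-halves {U = (true ∷ v) ∷ U} {true ∷ x} (there p) = there (∈⇒∈-halves p)

∈-halves⇒∈ : ∀ {n} {U : List (Bits (suc n))} → Halves U ⊆ (_∈ U)
∈-halves⇒∈ {U = []} {false ∷ x} ()
∈-halves⇒∈ {U = []} {true ∷ x} ()
∈-halves⇒∈ {U = (false ∷ v) ∷ U} {false ∷ x} (here refl) = here refl
∈-halves⇒∈ {U = (false ∷ v) ∷ U} {false ∷ x} (there p) = there (∈-halves⇒∈ p)
∈-halves⇒∈ {U = (false ∷ v) ∷ U} {true ∷ x} p = there (∈-halves⇒∈ p)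
∈-halves⇒∈ {U = (true ∷ v) ∷ U} {false ∷ x} p = there (∈-halves⇒∈ p)
∈-halves⇒∈ {U = (true ∷ v) ∷ U} {true ∷ x} (here refl) = here refl
∈-halves⇒∈ {U = (true ∷ v) ∷ U} {true ∷ x} (there p) = there (∈-halves⇒∈ p)

length-halves : ∀ {n} (U : List (Bits (suc n))) →
                length (half false U) + length (half true U) ≡ length U
length-halves [] = refl
length-halves ((false ∷ x) ∷ U) = cong suc (length-halves U)
length-halves ((true ∷ x) ∷ U) = trans (+-suc _ _) (cong suc (length-halves U))

both-< : ∀ {p q n} → suc p + suc q ≤ suc n → p < n × q < n
both-< {p} {q} {n} (s≤s p+q≤n) =
  m+n≤o⇒m≤o (suc p) (subst (_≤ n) (+-suc p q) p+q≤n) , m+n≤o⇒n≤o p p+q≤n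

matching : ∀ {n} (G : XQ n) (L : List (Bits n)) → length L ≤ n → Matching G (_∈ L) (_∈ L)

matching-join : ∀ {n} (G₀ G₁ : XQ n) φ (L₀ L₁ : List (Bits n)) → length L₀ + length L₁ ≤ suc n →
                Matching (join G₀ G₁ φ) ((_∈ L₀) ⊕ (_∈ L₁)) ((_∈ L₀) ⊕ (_∈ L₁))

matching k2 [] _ = empty-matching
matching k2 (x ∷ []) _ =
  restrict (λ { (here refl) → refl }) id
    (singleton-matching x~x′ λ { (here x′≡x) → adj⇒≢ k2 x~x′ (sym x′≡x) })
  where
  x~x′ : Adj k2 x (neighbour k2 x zero)
  x~x′ = neighbour-adj k2 x zero
matching k2 (_ ∷ _ ∷ _) (s≤s ())
matching (join G₀ G₁ φ) L L≤n =
  restrict ∈⇒∈-halves ∈⇒∈-halves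
    (matching-join G₀ G₁ φ (half false L) (half true L)
      (≤-trans (≤-reflexive (length-halves L)) L≤n))

matching-join G₀ G₁ φ [] L₁ _ = cross-matching G₀ G₁ φ λ { (false ∷ _) () ; (true ∷ _) _ () }
matching-join G₀ G₁ φ (_ ∷ _) [] _ = cross-matching G₀ G₁ φ λ { (false ∷ _) _ () ; (true ∷ _) () }
matching-join G₀ G₁ φ L₀@(_ ∷ _) L₁@(_ ∷ _) L≤ =
  join-matching G₀ G₁ φ (matching G₀ L₀ (proj₁ (both-< L≤))) (matching G₁ L₁ (proj₂ (both-< L≤)))

-- Dimension at least four

-- If a is the only exit of ℓ and of y, then y and ℓ, which are nonadjacent by triangle-freeness,
-- have all their neighbours in a ∷ L.
pair-matching-or-closed : ∀ {n} (G : XQ (3 + n)) {L y ℓ a} →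
  length L ≤ 4 + n → y ∈ L → ℓ ∈ L → y ≢ ℓ → Adj G y a → a ∉ L →
  Matching G (｛ y ｝ ∪ ｛ ℓ ｝) (_∈ L) ⊎ NeighboursIn G (_∈ L) ℓ
pair-matching-or-closed G {L} {y} {ℓ} {a} L≤ y∈L ℓ∈L y≢ℓ ya a∉L with exit? G (_∈? (a ∷ L)) ℓ
... | inj₁ (b , ℓb , b∉) =
  inj₁ (pair-matching G ya a∉L ℓb (b∉ ∘ there) (λ a≡b → b∉ (here (sym a≡b))))
... | inj₂ closed-ℓ with adj? G ℓ a
...   | no ℓ≁a = inj₂ (neighboursIn-∷ G ℓ≁a closed-ℓ)
...   | yes ℓa with exit? G (_∈? (a ∷ L)) y
...     | inj₁ (a′ , ya′ , a′∉) = inj₁ (pair-matching G ya′ (a′∉ ∘ there) ℓa a∉L (a′∉ ∘ here))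
...     | inj₂ closed-y = ⊥-elim (no-closed-twins G (s≤s L≤) (there y∈L) (there ℓ∈L) y≢ℓ
                                    (λ yℓ → triangle-free G yℓ ℓa ya) closed-y closed-ℓ)

pair-matching-with-one-of : ∀ {n} (G : XQ (3 + n)) {L y a ℓ₁ ℓ₂} →
  length L ≤ 4 + n → y ∈ L → Adj G y a → a ∉ L →
  ℓ₁ ∈ L → ℓ₂ ∈ L → ℓ₁ ≢ ℓ₂ → y ≢ ℓ₁ → y ≢ ℓ₂ →
  Matching G (｛ y ｝ ∪ ｛ ℓ₁ ｝) (_∈ L) ⊎ Matching G (｛ y ｝ ∪ ｛ ℓ₂ ｝) (_∈ L)
pair-matching-with-one-of G L≤ y∈L ya a∉L ℓ₁∈L ℓ₂∈L ℓ₁≢ℓ₂ y≢ℓ₁ y≢ℓ₂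
  with pair-matching-or-closed G L≤ y∈L ℓ₁∈L y≢ℓ₁ ya a∉L
     | pair-matching-or-closed G L≤ y∈L ℓ₂∈L y≢ℓ₂ ya a∉L
... | inj₁ M | _ = inj₁ M
... | inj₂ _ | inj₁ M = inj₂ M
... | inj₂ closed₁ | inj₂ closed₂ =
  ⊥-elim (no-two-closed G L≤ ℓ₁∈L ℓ₂∈L ℓ₁≢ℓ₂ closed₁ closed₂)

module _ {n} (G₀ G₁ : XQ n) (φ : Bits n ↔ Bits n) where

  -- Every node crosses except y, whose cross neighbour z is in U, and ℓ = φ⁻¹ t, whose cross
  -- neighbour t is taken by z; these two are matched inside G₀ by M₀.
  rerouted-matching : ∀ {L₀ y z t} → to φ y ≡ z → Adj G₁ z t →
    Matching G₀ ((_∈ L₀) ∩ (｛ y ｝ ∪ ｛ from φ t ｝)) (_∈ L₀) →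
    Matching (join G₀ G₁ φ) ((_∈ L₀) ⊕ (_∈ [ z ])) ((_∈ L₀) ⊕ (_∈ [ z ]))
  rerouted-matching {L₀} {y} {z} {t} y↦z zt M₀ =
    restrict (λ {x} → covered {x}) id (union-matching detoured? crossed detoured disjoint)
    where
    Detour : Pred (Bits n) 0ℓ
    Detour = ｛ y ｝ ∪ ｛ from φ t ｝
    detour? : Decidable Detour
    detour? = (y ≟_) ∪? (from φ t ≟_)
    U : Pred (Bits (suc n)) 0ℓ
    U = (_∈ L₀) ⊕ (_∈ [ z ])
    detoured : Matching (join G₀ G₁ φ) (((_∈ L₀) ∩ Detour) ⊕ ｛ z ｝) U
    detoured =
      join-matching G₀ G₁ φ M₀ (singleton-matching zt λ { (here t≡z) → adj⇒≢ G₁ zt (sym t≡z) })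
    detoured? : Decidable (((_∈ L₀) ∩ Detour) ⊕ ｛ z ｝)
    detoured? (false ∷ x) = ((_∈? L₀) ∩? detour?) x
    detoured? (true ∷ w) = z ≟ w
    crossed : Matching (join G₀ G₁ φ) (((_∈ L₀) ∖ Detour) ⊕ ∅) U
    crossed = cross-matching G₀ G₁ φ λ
      { (false ∷ x) (_ , x∉D) (here tx≡z) → x∉D (inj₁ (to-injective φ (trans y↦z (sym tx≡z)))) }
    disjoint : ∀ {x w} → (((_∈ L₀) ∖ Detour) ⊕ ∅) x → (((_∈ L₀) ∩ Detour) ⊕ ｛ z ｝) w →
               cross φ x ≢ partner detoured w
    disjoint {false ∷ x} {false ∷ w} _ _ ()
    disjoint {false ∷ x} {true ∷ w} (_ , x∉D) _ e =
      x∉D (inj₂ (inverseʳ φ (sym (Vec.∷-injectiveʳ e))))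
    covered : U ⊆ ((((_∈ L₀) ∖ Detour) ⊕ ∅) ∪ (((_∈ L₀) ∩ Detour) ⊕ ｛ z ｝))
    covered {false ∷ x} x∈L₀ with detour? x
    ... | yes d = inj₂ (x∈L₀ , d)
    ... | no ¬d = inj₁ (x∈L₀ , ¬d)
    covered {true ∷ w} (here w≡z) = inj₂ (sym w≡z)

matching-around-cross-edge : ∀ {k} (G₀ G₁ : XQ (3 + k)) φ {L₀ y z a} →
  length L₀ ≤ 4 + k → to φ y ≡ z → y ∈ L₀ → Adj G₀ y a → a ∉ L₀ →
  Matching (join G₀ G₁ φ) ((_∈ L₀) ⊕ (_∈ [ z ])) ((_∈ L₀) ⊕ (_∈ [ z ]))
matching-around-cross-edge {k} G₀ G₁ φ {L₀} {y} {z} {a} L₀≤ y↦z y∈L₀ ya a∉L₀ =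
  by-candidates (ℓ 0F ∈? L₀) (ℓ 1F ∈? L₀)
  where
  ℓ : Fin (3 + k) → Bits (3 + k)
  ℓ i = from φ (neighbour G₁ z i)
  U : Pred (Bits (4 + k)) 0ℓ
  U = (_∈ L₀) ⊕ (_∈ [ z ])
  reroute : ∀ i → Matching G₀ ((_∈ L₀) ∩ (｛ y ｝ ∪ ｛ ℓ i ｝)) (_∈ L₀) →
            Matching (join G₀ G₁ φ) U U
  reroute i = rerouted-matching G₀ G₁ φ y↦z (neighbour-adj G₁ z i)
  only-y : ∀ {v} → v ∉ L₀ → (_∈ L₀) ∩ (｛ y ｝ ∪ ｛ v ｝) ⊆ ｛ y ｝
  only-y _ (_ , inj₁ y≡x) = y≡x
  only-y v∉L₀ (x∈L₀ , inj₂ refl) = ⊥-elim (v∉L₀ x∈L₀)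
  y≢ℓ : ∀ i → y ≢ ℓ i
  y≢ℓ i y≡ℓ = adj⇒≢ G₁ (neighbour-adj G₁ z i) (trans (sym y↦z) (inverseˡ φ y≡ℓ))
  by-candidates : Dec (ℓ 0F ∈ L₀) → Dec (ℓ 1F ∈ L₀) → Matching (join G₀ G₁ φ) U U
  by-candidates (no ℓ∉L₀) _ =
    reroute 0F (restrict (only-y ℓ∉L₀) id (singleton-matching ya a∉L₀))
  by-candidates (yes _) (no ℓ∉L₀) =
    reroute 1F (restrict (only-y ℓ∉L₀) id (singleton-matching ya a∉L₀))
  by-candidates (yes ℓ₀∈L₀) (yes ℓ₁∈L₀) =
    [ reroute 0F ∘ restrict proj₂ id , reroute 1F ∘ restrict proj₂ id ]′
      (pair-matching-with-one-of G₀ L₀≤ y∈L₀ ya a∉L₀ ℓ₀∈L₀ ℓ₁∈L₀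
         (Fin.0≢1+n ∘ neighbour-injective G₁ z ∘ from-injective φ) (y≢ℓ 0F) (y≢ℓ 1F))

lone-cross-matching : ∀ {n} (G₀ G₁ : XQ n) φ {L₀ z} → from φ z ∉ L₀ →
  Matching (join G₀ G₁ φ) ((_∈ L₀) ⊕ (_∈ [ z ])) ((_∈ L₀) ⊕ (_∈ [ z ]))
lone-cross-matching G₀ G₁ φ {L₀} {z} y∉L₀ = cross-matching G₀ G₁ φ no-cross-edge
  where
  no-cross-edge : ∀ x → ((_∈ L₀) ⊕ (_∈ [ z ])) x → ¬ ((_∈ L₀) ⊕ (_∈ [ z ])) (cross φ x)
  no-cross-edge (false ∷ x) x∈L₀ (here tx≡z) =
    y∉L₀ (subst (_∈ L₀) (sym (inverseʳ φ (sym tx≡z))) x∈L₀)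
  no-cross-edge (true ∷ w) (here w≡z) fw∈L₀ = y∉L₀ (subst (λ v → from φ v ∈ L₀) w≡z fw∈L₀)

matching-lopsided : ∀ {k} (G₀ G₁ : XQ (3 + k)) φ (L₀ L₁ : List (Bits (3 + k))) →
  length L₀ + length L₁ ≤ 5 + k → length L₁ ≤ 1 →
  ExitsFrom (join G₀ G₁ φ) ((_∈ L₀) ⊕ (_∈ L₁)) →
  Matching (join G₀ G₁ φ) ((_∈ L₀) ⊕ (_∈ L₁)) ((_∈ L₀) ⊕ (_∈ L₁))
matching-lopsided G₀ G₁ φ L₀ [] _ _ _ =
  cross-matching G₀ G₁ φ λ { (false ∷ _) _ () ; (true ∷ _) () }
matching-lopsided G₀ G₁ φ L₀ (_ ∷ _ ∷ _) _ (s≤s ()) _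
matching-lopsided G₀ G₁ φ L₀ (z ∷ []) L≤ _ exits with from φ z ∈? L₀
... | no y∉L₀ = lone-cross-matching G₀ G₁ φ y∉L₀
... | yes y∈L₀ with exits (false ∷ from φ z) y∈L₀
...   | false ∷ a , ya , a∉L₀ =
  matching-around-cross-edge G₀ G₁ φ (≤-pred (≤-trans (≤-reflexive (+-comm 1 (length L₀))) L≤))
    (strictlyInverseˡ φ z) y∈L₀ ya a∉L₀
...   | true ∷ w , yw , w∉ = ⊥-elim (w∉ (here (trans (sym yw) (strictlyInverseˡ φ z))))

other-summand-≤1 : ∀ {k a b} → ¬ a ≤ k → a + b ≤ 2 + k → b ≤ 1
other-summand-≤1 {k} {a} {b} a≰k a+b≤ =
  +-cancelˡ-≤ (suc k) b 1
    (≤-trans (+-monoˡ-≤ b (≰⇒> a≰k)) (≤-trans a+b≤ (≤-reflexive (cong suc (+-comm 1 k)))))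

matching-with-exits-join : ∀ {k} (G₀ G₁ : XQ (3 + k)) φ (L₀ L₁ : List (Bits (3 + k))) →
  length L₀ + length L₁ ≤ 5 + k →
  ExitsFrom (join G₀ G₁ φ) ((_∈ L₀) ⊕ (_∈ L₁)) →
  Matching (join G₀ G₁ φ) ((_∈ L₀) ⊕ (_∈ L₁)) ((_∈ L₀) ⊕ (_∈ L₁))
matching-with-exits-join {k} G₀ G₁ φ L₀ L₁ L≤ exits
  with length L₀ ≤? 3 + k | length L₁ ≤? 3 + k
... | yes L₀≤ | yes L₁≤ = join-matching G₀ G₁ φ (matching G₀ L₀ L₀≤) (matching G₁ L₁ L₁≤)
... | no L₀≰ | _ = matching-lopsided G₀ G₁ φ L₀ L₁ L≤ (other-summand-≤1 L₀≰ L≤) exits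
... | yes _ | no L₁≰ =
  swap-matching G₀ G₁ φ
    (matching-lopsided G₁ G₀ (↔-sym φ) L₁ L₀ L≤′ (other-summand-≤1 L₁≰ L≤′) swapped-exits)
  where
  L≤′ : length L₁ + length L₀ ≤ 5 + k
  L≤′ = ≤-trans (≤-reflexive (+-comm (length L₁) (length L₀))) L≤
  swapped-exits : ExitsFrom (join G₁ G₀ (↔-sym φ)) ((_∈ L₁) ⊕ (_∈ L₀))
  swapped-exits (false ∷ x) = swap-exit G₀ G₁ φ (true ∷ x) ∘ exits (true ∷ x)
  swapped-exits (true ∷ x) = swap-exit G₀ G₁ φ (false ∷ x) ∘ exits (false ∷ x)

matching-with-exits : ∀ {k} (G : XQ (4 + k)) (U : List (Bits (4 + k))) →
  length U ≤ 5 + k → ExitsFrom G (_∈ U) → Matching G (_∈ U) (_∈ U)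
matching-with-exits (join G₀ G₁ φ) U U≤ exits =
  restrict ∈⇒∈-halves ∈⇒∈-halves
    (matching-with-exits-join G₀ G₁ φ (half false U) (half true U)
      (≤-trans (≤-reflexive (length-halves U)) U≤)
      halves-exits)
  where
  halves-exits : ExitsFrom (join G₀ G₁ φ) (Halves U)
  halves-exits x m with exits x (∈-halves⇒∈ m)
  ... | w , xw , w∉U = w , xw , w∉U ∘ ∈-halves⇒∈

lemma3p3 : (n : ℕ) → 4 ≤ n → (G : XQ n) → (u : Fin (suc n) → Bits n)
    → Injective _≡_ _≡_ u
    → ¬ Isomorphic (Induced G u) (StarAdj {n})
    → Σ (Fin (suc n) → Bits n) λ v
        → Injective _≡_ _≡_ v
        × (∀ i j → v i ≢ u j)
        × (∀ i → Adj G (u i) (v i))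
lemma3p3 n (s≤s (s≤s (s≤s (s≤s _)))) G u u-inj not-star =
    partner M ∘ u
  , (λ e → u-inj (partner-injective M (∈U _) (∈U _) e))
  , (λ i j e → partner-∉ M (∈U i) (subst (_∈ U) (sym e) (∈U j)))
  , (λ i → partner-adj M (∈U i))
  where
  U : List (Bits n)
  U = tabulate u
  ∈U : ∀ i → u i ∈ U
  ∈U = ∈-tabulate⁺ {f = u}
  exits : ExitsFrom G (_∈ U)
  exits x x∈U with ∈-tabulate⁻ {f = u} x∈U
  ... | i , refl = not-star⇒exit G u u-inj not-star i
  M : Matching G (_∈ U) (_∈ U)
  M = matching-with-exits G U (≤-reflexive (length-tabulate u)) exits
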